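{- Let $k,d$ be positive integers and $m\ge m_0(k,d)$. Let $\mathfrak{S}$ be a partition of $[0,k]^d$ such that $\{(0)^d\}\in\mathfrak{S}$ and $p^a_{\beta,\gamma}(m)=p^{a'}_{\beta,\gamma}(m)$ for all $\alpha,\beta,\gamma\in\mathfrak{S}$ and all $a,a'\in\alpha$ (equivalently, $\mathcal{J}(m,k)^{\mathfrak S}$ is a fusion of $\mathcal{J}(m,k)^d$). Let $\beta\in\mathfrak{S}$. Then: (1) $D_\beta$ is a union of cells of $\mathfrak{S}$, and every element of $D_\beta\setminus\beta$ has weight less than $\mathrm{wt}(\beta)$; (2) for every $\alpha\in\mathfrak{S}$ there is a constant $N^\beta_\alpha$ such that $\sum_{b:\,a\le b\in\beta^*}\binom{(k)^d-a}{(k)^d-b}=N^\beta_\alpha$ for all $a\in\alpha$; (3) every element of $\beta$ is dominated by a unique element of $\beta^*$; (4) either $\mathrm{wt}(\beta)=\mathrm{wt}(D_\beta\setminus\beta)+1$ or $\beta^*\subseteq\{0,k\}^d$.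
   Context: Notation for vectors in $[0,k]^d=\{0,\dots,k\}^d$: $a\le b$ iff $a_i\le b_i$ for all $i$ ($b$ dominates $a$); $\mathrm{wt}(a)=a_1+\dots+a_d$; $\binom{a}{b}=\prod_i\binom{a_i}{b_i}$ (zero unless $(0)^d\le b\le a$); $(x)^d=(x,\dots,x)$; $[a]=\{b\in[0,k]^d:b\le a\}$. For nonempty $S\subseteq[0,k]^d$, $\mathrm{wt}(S)=\max\{\mathrm{wt}(b):b\in S\}$. For $\beta\in\mathfrak{S}$, $\beta^*$ is the set of elements of $\beta$ of maximal weight and $D_\beta=\bigcup_{a\in\beta^*}[a]$. Structure constants: for $0\le a,b,c\le k$, $p^a_{b,c}(m)=\sum_i\binom{k-a}{i}\binom{a}{k-b-i}\binom{a}{k-c-i}\binom{m-k-a}{b+c+i-k}$ (the intersection numbers of the Johnson scheme $\mathcal{J}(m,k)$, a polynomial in $m$); for $a,b,c\in[0,k]^d$, $p^a_{b,c}(m)=\prod_{i}p^{a_i}_{b_i,c_i}(m)$; for $\beta,\gamma\subseteq[0,k]^d$, $p^a_{\beta,\gamma}(m)=\sum_{b\in\beta,c\in\gamma}p^a_{b,c}(m)$. The constant $m_0(k,d)\ge 3k$ is chosen so that for $m\ge m_0(k,d)$, for all $\beta,\gamma\subseteq[0,k]^d$ and $a,a'\in[0,k]^d$, the equality $p^a_{\beta,\gamma}(m)=p^{a'}_{\beta,\gamma}(m)$ of numbers implies equality of $p^a_{\beta,\gamma}$ and $p^{a'}_{\beta,\gamma}$ as polynomials in $m$ (such a constant exists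 since distinct polynomials agree only at finitely many points). -}

module Defs where

open import Data.Nat using (ℕ; zero; suc; _+_; _*_; _∸_; _≤_; _<_; _⊔_; _≤ᵇ_; _≡ᵇ_)
open import Data.Nat.Combinatorics using (_C_)
open import Data.Fin using (Fin; toℕ)
open import Data.Vec using (Vec; []; _∷_)
import Data.Vec as V
open import Data.List using (List; []; _∷_; map; concatMap; allFin; filterᵇ; foldr; upTo)
open import Data.Bool.ListAction using (any)
open import Data.Nat.ListAction using (sum)
open import Data.Product using (Σ; _×_)
open import Relation.Binary.PropositionalEquality using (_≡_)
open import Data.Bool using (Bool; true; false; _∧_; _∨_; not; if_then_else_)

Pt : ℕ → ℕ → Set
Pt k d = Vec (Fin (suc k)) d

allPts : (k d : ℕ) → List (Pt k d)
allPts k zero    = [] ∷ []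
allPts k (suc d) = concatMap (λ i → map (i ∷_) (allPts k d)) (allFin (suc k))

zeroPt : (k d : ℕ) → Pt k d
zeroPt k d = V.replicate d Fin.zero
  where import Data.Fin as Fin

wt : ∀ {k d} → Pt k d → ℕ
wt v = V.foldr _ (λ x s → toℕ x + s) 0 v

_≼ᵇ_ : ∀ {k d} → Pt k d → Pt k d → Bool
[] ≼ᵇ [] = true
(x ∷ xs) ≼ᵇ (y ∷ ys) = (toℕ x ≤ᵇ toℕ y) ∧ (xs ≼ᵇ ys)

Subset : ℕ → ℕ → Set
Subset k d = Pt k d → Bool

-- wt(S) = max weight of an element of S (only meaningful for nonempty S)
wtS : ∀ {k d} → Subset k d → ℕ
wtS {k} {d} S = foldr _⊔_ 0 (map wt (filterᵇ S (allPts k d)))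

star : ∀ {k d} → Subset k d → Subset k d
star S x = S x ∧ (wt x ≡ᵇ wtS S)

Dn : ∀ {k d} → Subset k d → Subset k d
Dn {k} {d} S x = any (λ a → star S a ∧ (x ≼ᵇ a)) (allPts k d)

_∖_ : ∀ {k d} → Subset k d → Subset k d → Subset k d
(S ∖ T) x = S x ∧ not (T x)

Nonempty : ∀ {k d} → Subset k d → Set
Nonempty S = Σ _ (λ x → S x ≡ true)

-- the cell of a partition (given by a labelling `lab`) containing y
cellOf : ∀ {k d} → (Pt k d → ℕ) → Pt k d → Subset k d
cellOf lab y x = lab x ≡ᵇ lab y

-- one term of the Johnson intersection number p^a_{b,c}(m); a term whose
-- lower binomial index would be a negative integer is 0.
pTerm : (k m a b c i : ℕ) → ℕ
pTerm k m a b c i =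
  if (b + i ≤ᵇ k) ∧ (c + i ≤ᵇ k) ∧ (k ≤ᵇ b + c + i)
  then ((k ∸ a) C i) * (a C (k ∸ b ∸ i)) * (a C (k ∸ c ∸ i))
         * ((m ∸ k ∸ a) C (b + c + i ∸ k))
  else 0

-- p^a_{b,c}(m) for 0 ≤ a,b,c ≤ k (sum over i; terms with i > k vanish)
pJ : (k m a b c : ℕ) → ℕ
pJ k m a b c = sum (map (pTerm k m a b c) (upTo (suc k)))

pPt : ∀ {k d} → ℕ → Pt k d → Pt k d → Pt k d → ℕ
pPt {k} m [] [] [] = 1
pPt {k} m (a ∷ as) (b ∷ bs) (c ∷ cs) = pJ k m (toℕ a) (toℕ b) (toℕ c) * pPt m as bs cs

pSet : ∀ {k d} → ℕ → Pt k d → Subset k d → Subset k d → ℕ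
pSet {k} {d} m a β γ =
  sum (map (λ b → sum (map (λ c → pPt m a b c) (filterᵇ γ (allPts k d))))
           (filterᵇ β (allPts k d)))

-- binom((k)^d - a, (k)^d - b) = ∏_i C(k - a_i, k - b_i)
binomKK : ∀ {k d} → Pt k d → Pt k d → ℕ
binomKK [] [] = 1
binomKK {k} (a ∷ as) (b ∷ bs) = ((k ∸ toℕ a) C (k ∸ toℕ b)) * binomKK as bs

Nsum : ∀ {k d} → Subset k d → Pt k d → ℕ
Nsum {k} {d} β a = sum (map (binomKK a) (filterᵇ (λ b → (a ≼ᵇ b) ∧ star β b) (allPts k d)))

in0k : ∀ {k d} → Pt k d → Bool
in0k [] = true
in0k {k} (x ∷ xs) = ((toℕ x ≡ᵇ 0) ∨ (toℕ x ≡ᵇ k)) ∧ in0k xs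

-- Equality "as polynomials in m" of p^a_{β,γ} and p^{a'}_{β,γ}.  For n ≥ 3k
-- the ℕ-valued pSet agrees with the value of the polynomial at n, and two
-- polynomials are equal iff they agree at infinitely many points; so
-- polynomial equality is expressed as agreement at every n ≥ 3k.
PolyEq : ∀ {k d} → Pt k d → Pt k d → Subset k d → Subset k d → Set
PolyEq {k} a a' β γ = ∀ n → 3 * k ≤ n → pSet n a β γ ≡ pSet n a' β γ

IsM0 : (k d m₀ : ℕ) → Set
IsM0 k d m₀ = (3 * k ≤ m₀) ×
  (∀ m → m₀ ≤ m → (β γ : Subset k d) (a a' : Pt k d) →
     pSet m a β γ ≡ pSet m a' β γ → PolyEq a a' β γ)

module Submission where

-- For fixed a and β, n ↦ p^a_{β,β}(n) is (for n ≥ 3k) a polynomial of degree ≤ wt(β), and its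
-- top difference is L_β(a) = Σ_{b ∈ β*} mult(b) · C((k)^d − a, (k)^d − b), mult(b) being the
-- multinomial coefficient of b: the top difference of p^a_{b,c} (degree ≤ wt b) vanishes unless
-- b ≤ c, it equals mult(b) · C((k)^d − a, (k)^d − b) for c = b, and inside β a dominator of b
-- of maximal weight is b itself.  Fusion and the choice of m₀ make p^a_{β,β} and p^{a'}_{β,β}
-- equal polynomials for a, a' in one cell, so L_β is constant on cells.  At the points of β*
-- this makes mult constant on β*, hence N^β = L_β / mult is constant on cells, which is (2).
-- As N^β = 1 on β*, it is 1 on all of β, which is (3); D_β is the support of N^β, so it is a
-- union of cells, which is (1).  For (4), lowering a coordinate of some b ∈ β* that lies
-- strictly between 0 and k gives a ∈ D_β of weight wt(β) − 1 with N^β(a) ≥ 2, so a ∉ β.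

open import Defs
open import Data.Bool using (Bool; true; false; _∧_; not; if_then_else_)
open import Data.Bool.Properties using (T-≡; ∧-conicalˡ; ∧-conicalʳ; if-eta; if-cong-then)
open import Data.Fin using (Fin; toℕ; inject₁) renaming (zero to fzero; suc to fsuc)
import Data.Fin.Properties as Fin
open import Data.Fin.Properties using (toℕ-injective; toℕ≤pred[n]; toℕ-inject₁)
open import Data.List
  using (List; []; _∷_; [_]; map; concat; tabulate; allFin; filterᵇ; foldr; upTo; applyUpTo)
open import Data.List.Membership.Propositional using (_∈_; lose)
open import Data.List.Membership.Propositional.Properties
  using (∈-map⁺; ∈-map⁻; ∈-concat⁺′; ∈-allFin; ∈-filter⁺; ∈-filter⁻)
open import Data.List.Properties using (map-cong; map-∘; map-++; map-tabulate; map-applyUpTo)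
open import Data.List.Relation.Unary.Any using (here; there; satisfied)
open import Data.List.Relation.Unary.Any.Properties using (any⁺; any⁻)
open import Data.Nat using (ℕ; zero; suc; _+_; _*_; _∸_; _≤_; _<_; _⊔_; _≤ᵇ_; _≡ᵇ_; z≤n; s≤s; >-nonZero)
open import Data.Nat.Properties
open import Data.Nat.Combinatorics
  using (_C_; nCn≡1; nC1≡n; nCk≡nC[n∸k]; k>n⇒nCk≡0; nCk+nC[k+1]≡[n+1]C[k+1])
open import Data.Nat.ListAction using (sum)
open import Data.Nat.ListAction.Properties using (sum-++)
open import Data.Nat.Tactic.RingSolver using (solve-∀)
open import Data.Product using (Σ; _×_; _,_; proj₁; proj₂; swap)
open import Data.Sum using (_⊎_; inj₁; inj₂)
open import Data.Vec using ([]; _∷_; head; tail)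
open import Function using (_∘_; Equivalence)
open import Relation.Binary.PropositionalEquality hiding ([_])
open import Relation.Nullary using (contradiction)
open import Relation.Nullary.Decidable using (T?)

private variable
  A : Set
  k d : ℕ

≡ᵇ-sound : ∀ {m n} → (m ≡ᵇ n) ≡ true → m ≡ n
≡ᵇ-sound {m} {n} = ≡ᵇ⇒≡ m n ∘ Equivalence.from T-≡

≡ᵇ-complete : ∀ {m n} → m ≡ n → (m ≡ᵇ n) ≡ true
≡ᵇ-complete {m} {n} = Equivalence.to T-≡ ∘ ≡⇒≡ᵇ m n

≤ᵇ-sound : ∀ {m n} → (m ≤ᵇ n) ≡ true → m ≤ n
≤ᵇ-sound {m} {n} = ≤ᵇ⇒≤ m n ∘ Equivalence.from T-≡

≤ᵇ-complete : ∀ {m n} → m ≤ n → (m ≤ᵇ n) ≡ true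
≤ᵇ-complete = Equivalence.to T-≡ ∘ ≤⇒≤ᵇ

∧≡true⁻ : ∀ a b → a ∧ b ≡ true → a ≡ true × b ≡ true
∧≡true⁻ a b e = ∧-conicalˡ a b e , ∧-conicalʳ a b e

∈-filterᵇ⁺ : ∀ (p : A → Bool) {x xs} → x ∈ xs → p x ≡ true → x ∈ filterᵇ p xs
∈-filterᵇ⁺ p x∈xs px = ∈-filter⁺ (T? ∘ p) x∈xs (Equivalence.from T-≡ px)

∈-filterᵇ⁻ : ∀ (p : A → Bool) xs {x} → x ∈ filterᵇ p xs → p x ≡ true
∈-filterᵇ⁻ p xs x∈ = Equivalence.to T-≡ (proj₂ (∈-filter⁻ (T? ∘ p) {xs = xs} x∈))

sum-cong : ∀ {f g : A → ℕ} xs → (∀ x → f x ≡ g x) → sum (map f xs) ≡ sum (map g xs)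
sum-cong xs f≡g = cong sum (map-cong f≡g xs)

sum-zero : ∀ {f : A → ℕ} xs → (∀ x → f x ≡ 0) → sum (map f xs) ≡ 0
sum-zero []       f≡0 = refl
sum-zero (x ∷ xs) f≡0 rewrite f≡0 x = sum-zero xs f≡0

sum-scale : ∀ q (f : A → ℕ) xs → sum (map (λ x → q * f x) xs) ≡ q * sum (map f xs)
sum-scale q f []       = sym (*-zeroʳ q)
sum-scale q f (x ∷ xs) rewrite sum-scale q f xs = sym (*-distribˡ-+ q (f x) (sum (map f xs)))

sum-filterᵇ : ∀ (p : A → Bool) (f : A → ℕ) xs →
              sum (map f (filterᵇ p xs)) ≡ sum (map (λ x → if p x then f x else 0) xs)
sum-filterᵇ p f []       = refl
sum-filterᵇ p f (x ∷ xs) with p x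
... | true  = cong (f x +_) (sum-filterᵇ p f xs)
... | false = sum-filterᵇ p f xs

sum-concat : ∀ (f : A → ℕ) xss → sum (map f (concat xss)) ≡ sum (map (λ xs → sum (map f xs)) xss)
sum-concat f []         = refl
sum-concat f (xs ∷ xss) rewrite map-++ f xs (concat xss) | sum-++ (map f xs) (map f (concat xss)) =
  cong (sum (map f xs) +_) (sum-concat f xss)

∈⇒≤sum : ∀ (f : A → ℕ) {x xs} → x ∈ xs → f x ≤ sum (map f xs)
∈⇒≤sum f (here refl)          = m≤m+n _ _
∈⇒≤sum f {xs = y ∷ _} (there x∈) = ≤-trans (∈⇒≤sum f x∈) (m≤n+m _ (f y))

sum≡1⇒singleton : ∀ (f : A → ℕ) xs → sum (map f xs) ≡ 1 → (∀ x → x ∈ xs → 1 ≤ f x) →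
                  Σ A (λ b → xs ≡ [ b ])
sum≡1⇒singleton f []           ()
sum≡1⇒singleton f (b ∷ [])     _   _   = b , refl
sum≡1⇒singleton f (b ∷ c ∷ xs) Σ≡1 pos = contradiction (subst (2 ≤_) Σ≡1 two≤Σ) λ { (s≤s ()) }
  where
    two≤Σ : 2 ≤ f b + (f c + sum (map f xs))
    two≤Σ = +-mono-≤ (pos b (here refl)) (≤-trans (pos c (there (here refl))) (m≤m+n _ _))

sum-tabulate-single : ∀ {n} (f : Fin n → ℕ) i → (∀ j → j ≢ i → f j ≡ 0) → sum (tabulate f) ≡ f i
sum-tabulate-single {suc n} f fzero others =
  trans (cong (f fzero +_) (trans (cong sum (sym (map-tabulate (λ j → j) (f ∘ fsuc))))
                                  (sum-zero (allFin n) λ j → others (fsuc j) λ ())))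
        (+-identityʳ _)
sum-tabulate-single {suc n} f (fsuc i) others rewrite others fzero (λ ()) =
  sum-tabulate-single (f ∘ fsuc) i λ j j≢i → others (fsuc j) (j≢i ∘ Fin.suc-injective)

sum-applyUpTo-single : ∀ (f : ℕ → ℕ) {n i} → i < n → (∀ j → j ≢ i → f j ≡ 0) → sum (applyUpTo f n) ≡ f i
sum-applyUpTo-single f {suc n} {zero} _ others =
  trans (cong (f 0 +_) (vanish {f} n (λ j → others (suc j) λ ()))) (+-identityʳ _)
  where
    vanish : ∀ {g : ℕ → ℕ} n → (∀ j → g (suc j) ≡ 0) → sum (applyUpTo (g ∘ suc) n) ≡ 0
    vanish zero    _    = refl
    vanish {g} (suc n) g≡0 rewrite g≡0 0 = vanish {g ∘ suc} n (g≡0 ∘ suc)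
sum-applyUpTo-single f {suc n} {suc i} (s≤s i<n) others rewrite others 0 (λ ()) =
  sum-applyUpTo-single (f ∘ suc) i<n λ j j≢i → others (suc j) (j≢i ∘ suc-injective)

⇒-or-counterexample : (p q : A → Bool) (xs : List A) →
  (∀ x → x ∈ xs → p x ≡ true → q x ≡ true) ⊎ Σ A (λ x → p x ≡ true × q x ≡ false)
⇒-or-counterexample p q []       = inj₁ λ _ ()
⇒-or-counterexample p q (x ∷ xs) with p x in px | q x in qx | ⇒-or-counterexample p q xs
... | true  | false | _       = inj₂ (x , px , qx)
... | _     | _     | inj₂ cx = inj₂ cx
... | true  | true  | inj₁ xs⇒ = inj₁ λ { _ (here refl) _   → qx
                                        ; y (there y∈)      → xs⇒ y y∈ }
... | false | _     | inj₁ xs⇒ = inj₁ λ { _ (here refl) px′ → contradiction (trans (sym px) px′) λ ()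
                                        ; y (there y∈)      → xs⇒ y y∈ }

max : List ℕ → ℕ
max = foldr _⊔_ 0

∈⇒≤max : ∀ {x xs} → x ∈ xs → x ≤ max xs
∈⇒≤max {xs = x ∷ xs} (here refl) = m≤m⊔n x (max xs)
∈⇒≤max {xs = y ∷ xs} (there x∈) = ≤-trans (∈⇒≤max x∈) (m≤n⊔m y (max xs))

max≤ : ∀ xs {B} → (∀ x → x ∈ xs → x ≤ B) → max xs ≤ B
max≤ []       _  = z≤n
max≤ (x ∷ xs) ≤B = ⊔-lub (≤B x (here refl)) (max≤ xs (λ y y∈ → ≤B y (there y∈)))

max∈ : ∀ {x xs} → x ∈ xs → max xs ∈ xs
max∈ {xs = y ∷ ys} _ = max-∷∈ y ys
  where
    max-∷∈ : ∀ y ys → max (y ∷ ys) ∈ y ∷ ys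
    max-∷∈ y []       = subst (_∈ [ y ]) (sym (⊔-identityʳ y)) (here refl)
    max-∷∈ y (z ∷ zs) with ⊔-sel y (max (z ∷ zs))
    ... | inj₁ ≡y    = subst (_∈ y ∷ z ∷ zs) (sym ≡y) (here refl)
    ... | inj₂ ≡rest = subst (_∈ y ∷ z ∷ zs) (sym ≡rest) (there (max-∷∈ z zs))

module Polynomial (N₀ : ℕ) where

  -- Poly f D c : for n ≥ N₀, f is a polynomial of degree ≤ D whose D-th forward
  -- difference is the constant c (so c / D! is its coefficient of n^D).
  data Poly (f : ℕ → ℕ) : ℕ → ℕ → Set where
    constant   : ∀ {c} → (∀ n → N₀ ≤ n → f n ≡ c) → Poly f 0 c
    difference : ∀ {D c} (g : ℕ → ℕ) → Poly g D c →
                 (∀ n → N₀ ≤ n → f (suc n) ≡ f n + g n) → Poly f (suc D) c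

  Poly-cong : ∀ {f h D c} → (∀ n → N₀ ≤ n → f n ≡ h n) → Poly f D c → Poly h D c
  Poly-cong f≡h (constant f≡c) = constant λ n n≥ → trans (sym (f≡h n n≥)) (f≡c n n≥)
  Poly-cong f≡h (difference g p Δf) = difference g p λ n n≥ →
    trans (sym (f≡h (suc n) (m≤n⇒m≤1+n n≥))) (trans (Δf n n≥) (cong (_+ _) (f≡h n n≥)))

  Poly-top-unique : ∀ {f h D c c'} → Poly f D c → Poly h D c' → (∀ n → N₀ ≤ n → f n ≡ h n) → c ≡ c'
  Poly-top-unique (constant f≡c) (constant h≡c') f≡h =
    trans (sym (f≡c N₀ ≤-refl)) (trans (f≡h N₀ ≤-refl) (h≡c' N₀ ≤-refl))
  Poly-top-unique {f} {h} (difference g p Δf) (difference g' q Δh) f≡h =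
    Poly-top-unique p q λ n n≥ → +-cancelˡ-≡ (f n) (g n) (g' n) (begin
      f n + g n   ≡⟨ sym (Δf n n≥) ⟩
      f (suc n)   ≡⟨ f≡h (suc n) (m≤n⇒m≤1+n n≥) ⟩
      h (suc n)   ≡⟨ Δh n n≥ ⟩
      h n + g' n  ≡⟨ cong (_+ g' n) (sym (f≡h n n≥)) ⟩
      f n + g' n  ∎)
    where open ≡-Reasoning

  Poly-const : ∀ c → Poly (λ _ → c) 0 c
  Poly-const c = constant λ _ _ → refl

  Poly-raise : ∀ {f D c} → Poly f D c → Poly f (suc D) 0
  Poly-raise {f} (constant f≡c) = difference (λ _ → 0) (Poly-const 0) λ n n≥ →
    trans (f≡c (suc n) (m≤n⇒m≤1+n n≥)) (trans (sym (f≡c n n≥)) (sym (+-identityʳ (f n))))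
  Poly-raise (difference g p Δf) = difference g (Poly-raise p) Δf

  Poly-0 : ∀ D → Poly (λ _ → 0) D 0
  Poly-0 zero    = Poly-const 0
  Poly-0 (suc D) = Poly-raise (Poly-0 D)

  Poly-raise< : ∀ {f j c} D → j < D → Poly f j c → Poly f D 0
  Poly-raise< (suc D) (s≤s j≤D) p with m≤n⇒m<n∨m≡n j≤D
  ... | inj₁ j<D  = Poly-raise (Poly-raise< D j<D p)
  ... | inj₂ refl = Poly-raise p

  Poly-raise≤ : ∀ {f j c} D → j ≤ D → Poly f j c → Poly f D (if j ≡ᵇ D then c else 0)
  Poly-raise≤ {f} {j} {c} D j≤D p with j ≡ᵇ D in j≟D
  ... | true  = subst (λ e → Poly f e c) (≡ᵇ-sound j≟D) p
  ... | false = Poly-raise< D (≤∧≢⇒< j≤D λ j≡D → contradiction (trans (sym j≟D) (≡ᵇ-complete j≡D)) λ ()) p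

  Poly-+ : ∀ {f g D c e} → Poly f D c → Poly g D e → Poly (λ n → f n + g n) D (c + e)
  Poly-+ (constant f≡c) (constant g≡e) = constant λ n n≥ → cong₂ _+_ (f≡c n n≥) (g≡e n n≥)
  Poly-+ {f} {g} (difference f' p Δf) (difference g' q Δg) =
    difference (λ n → f' n + g' n) (Poly-+ p q) λ n n≥ →
      trans (cong₂ _+_ (Δf n n≥) (Δg n n≥)) (interchange (f n) (f' n) (g n) (g' n))
    where
      interchange : ∀ a b c d → a + b + (c + d) ≡ a + c + (b + d)
      interchange = solve-∀

  Poly-scale : ∀ {f D c} q → Poly f D c → Poly (λ n → q * f n) D (q * c)
  Poly-scale q (constant f≡c) = constant λ n n≥ → cong (q *_) (f≡c n n≥)
  Poly-scale {f} q (difference g p Δf) = difference (λ n → q * g n) (Poly-scale q p) λ n n≥ →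
    trans (cong (q *_) (Δf n n≥)) (*-distribˡ-+ q (f n) (g n))

  Poly-shift : ∀ {f D c} → Poly f D c → Poly (λ n → f (suc n)) D c
  Poly-shift (constant f≡c) = constant λ n n≥ → f≡c (suc n) (m≤n⇒m≤1+n n≥)
  Poly-shift (difference g p Δf) = difference (λ n → g (suc n)) (Poly-shift p) λ n n≥ →
    Δf (suc n) (m≤n⇒m≤1+n n≥)

  -- Leibniz rule Δ(f g)(n) = Δf(n) g(n+1) + f(n) Δg(n); the top differences
  -- then satisfy Pascal's recurrence.
  Poly-* : ∀ {f g} D E {c e} → Poly f D c → Poly g E e →
           Poly (λ n → f n * g n) (D + E) (((D + E) C D) * c * e)
  Poly-* {f} {g} zero E {c} {e} (constant f≡c) q =
    subst (Poly _ E) (cong (_* e) (sym (*-identityˡ c)))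
      (Poly-cong (λ n n≥ → cong (_* g n) (sym (f≡c n n≥))) (Poly-scale c q))
  Poly-* {f} {g} (suc D) zero {c} {e} p (constant g≡e) =
    subst₂ (Poly _) (sym (+-identityʳ (suc D))) coefficient
      (Poly-cong (λ n n≥ → trans (*-comm e (f n)) (cong (f n *_) (sym (g≡e n n≥)))) (Poly-scale e p))
    where
      coefficient : e * c ≡ ((suc D + 0) C suc D) * c * e
      coefficient = trans (*-comm e c) (trans (cong (_* e) (sym (*-identityˡ c)))
        (cong (λ x → x * c * e) (sym (trans (cong (_C suc D) (+-identityʳ (suc D))) (nCn≡1 (suc D))))))
  Poly-* {f} {g} (suc D) (suc E) {c} {e} p@(difference f' p' Δf) q@(difference g' q' Δg) =
    subst₂ (Poly _) (cong suc (sym (+-suc D E))) coefficient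
      (difference (λ n → f' n * g (suc n) + f n * g' n) (Poly-+ left right) leibniz)
    where
      left : Poly (λ n → f' n * g (suc n)) (suc (D + E)) (((D + suc E) C D) * c * e)
      left = subst (λ n → Poly (λ n → f' n * g (suc n)) n (((D + suc E) C D) * c * e)) (+-suc D E)
               (Poly-* D (suc E) p' (Poly-shift q))
      right : Poly (λ n → f n * g' n) (suc (D + E)) (((suc D + E) C suc D) * c * e)
      right = Poly-* (suc D) E p q'
      pascal : (D + suc E) C D + (suc D + E) C suc D ≡ (suc D + suc E) C suc D
      pascal = trans (cong (λ n → (D + suc E) C D + n C suc D) (sym (+-suc D E)))
                     (nCk+nC[k+1]≡[n+1]C[k+1] (D + suc E) D)
      distrib : ∀ x y a b → x * a * b + y * a * b ≡ (x + y) * a * b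
      distrib = solve-∀
      coefficient : ((D + suc E) C D) * c * e + ((suc D + E) C suc D) * c * e
                  ≡ ((suc D + suc E) C suc D) * c * e
      coefficient = trans (distrib ((D + suc E) C D) ((suc D + E) C suc D) c e)
                          (cong (λ x → x * c * e) pascal)
      leibniz : ∀ n → N₀ ≤ n → f (suc n) * g (suc n) ≡ f n * g n + (f' n * g (suc n) + f n * g' n)
      leibniz n n≥ rewrite Δf n n≥ | Δg n n≥ = expand (f n) (f' n) (g n) (g' n)
        where
          expand : ∀ a b c d → (a + b) * (c + d) ≡ a * c + (b * (c + d) + a * d)
          expand = solve-∀

  Poly-if : ∀ {f D c} (b : Bool) → (b ≡ true → Poly f D c) →
            Poly (λ n → if b then f n else 0) D (if b then c else 0)
  Poly-if {D = D} false _ = Poly-0 D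
  Poly-if true p = p refl

  Poly-sum : ∀ {A : Set} {D} (xs : List A) {h : A → ℕ → ℕ} {t : A → ℕ} → (∀ x → Poly (h x) D (t x)) →
             Poly (λ n → sum (map (λ x → h x n) xs)) D (sum (map t xs))
  Poly-sum {D = D} [] p = Poly-0 D
  Poly-sum (x ∷ xs) p = Poly-+ (p x) (Poly-sum xs p)

  Poly-binomial : ∀ s j → s ≤ N₀ → Poly (λ n → (n ∸ s) C j) j 1
  Poly-binomial s zero s≤N₀ = constant λ _ _ → refl
  Poly-binomial s (suc j) s≤N₀ = difference (λ n → (n ∸ s) C j) (Poly-binomial s j s≤N₀) λ n n≥ →
    trans (cong (_C suc j) (+-∸-assoc 1 (≤-trans s≤N₀ n≥)))
          (trans (sym (nCk+nC[k+1]≡[n+1]C[k+1] (n ∸ s) j)) (+-comm ((n ∸ s) C j) _))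

allPts-complete : ∀ (x : Pt k d) → x ∈ allPts k d
allPts-complete []       = here refl
allPts-complete {k} (i ∷ xs) =
  ∈-concat⁺′ (∈-map⁺ (i ∷_) (allPts-complete xs)) (∈-map⁺ (λ j → map (j ∷_) (allPts k _)) (∈-allFin i))

sum-allPts-single : ∀ (f : Pt k d → ℕ) b → (∀ c → c ≢ b → f c ≡ 0) → sum (map f (allPts k d)) ≡ f b
sum-allPts-single {d = zero} f [] _ = +-identityʳ (f [])
sum-allPts-single {k} {suc d} f (i ∷ b) others = begin
  sum (map f (concat (map row (allFin (suc k)))))
    ≡⟨ sum-concat f (map row (allFin (suc k))) ⟩
  sum (map (λ xs → sum (map f xs)) (map row (tabulate (λ j → j))))
    ≡⟨ cong sum (trans (sym (map-∘ (tabulate (λ j → j))))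
                       (map-tabulate (λ j → j) (λ j → sum (map f (row j))))) ⟩
  sum (tabulate (λ j → sum (map f (row j))))
    ≡⟨ sum-tabulate-single (λ j → sum (map f (row j))) i other-rows ⟩
  sum (map f (row i))
    ≡⟨ cong sum (sym (map-∘ (allPts k d))) ⟩
  sum (map (λ c → f (i ∷ c)) (allPts k d))
    ≡⟨ sum-allPts-single (λ c → f (i ∷ c)) b (λ c c≢b → others (i ∷ c) (c≢b ∘ cong tail)) ⟩
  f (i ∷ b) ∎
  where
    open ≡-Reasoning
    row : Fin (suc k) → List (Pt k (suc d))
    row j = map (j ∷_) (allPts k d)
    other-rows : ∀ j → j ≢ i → sum (map f (row j)) ≡ 0
    other-rows j j≢i = trans (cong sum (sym (map-∘ (allPts k d))))
                             (sum-zero (allPts k d) λ c → others (j ∷ c) (j≢i ∘ cong head))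

≼ᵇ-refl : ∀ (x : Pt k d) → (x ≼ᵇ x) ≡ true
≼ᵇ-refl []       = refl
≼ᵇ-refl (i ∷ xs) rewrite ≤ᵇ-complete (≤-refl {toℕ i}) = ≼ᵇ-refl xs

≼ᵇ-∷⁻ : ∀ (i j : Fin (suc k)) (xs ys : Pt k d) → ((i ∷ xs) ≼ᵇ (j ∷ ys)) ≡ true →
        toℕ i ≤ toℕ j × (xs ≼ᵇ ys) ≡ true
≼ᵇ-∷⁻ i j xs ys e = let i≤ᵇj , xs≼ys = ∧≡true⁻ (toℕ i ≤ᵇ toℕ j) (xs ≼ᵇ ys) e in ≤ᵇ-sound i≤ᵇj , xs≼ys

≼ᵇ⇒wt≤ : ∀ (x a : Pt k d) → (x ≼ᵇ a) ≡ true → wt x ≤ wt a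
≼ᵇ⇒wt≤ []       []       _   = z≤n
≼ᵇ⇒wt≤ (i ∷ xs) (j ∷ as) x≼a = let i≤j , xs≼as = ≼ᵇ-∷⁻ i j xs as x≼a in +-mono-≤ i≤j (≼ᵇ⇒wt≤ xs as xs≼as)

≼ᵇ∧wt≥⇒≡ : ∀ (x a : Pt k d) → (x ≼ᵇ a) ≡ true → wt a ≤ wt x → x ≡ a
≼ᵇ∧wt≥⇒≡ []       []       _   _ = refl
≼ᵇ∧wt≥⇒≡ (i ∷ xs) (j ∷ as) x≼a wa≤wx =
  cong₂ _∷_ (toℕ-injective (≤-antisym i≤j j≤i)) (≼ᵇ∧wt≥⇒≡ xs as xs≼as was≤wxs)
  where
    i≤j = proj₁ (≼ᵇ-∷⁻ i j xs as x≼a)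
    xs≼as = proj₂ (≼ᵇ-∷⁻ i j xs as x≼a)
    j≤i : toℕ j ≤ toℕ i
    j≤i = +-cancelʳ-≤ (wt as) (toℕ j) (toℕ i) (≤-trans wa≤wx (+-monoʳ-≤ (toℕ i) (≼ᵇ⇒wt≤ xs as xs≼as)))
    was≤wxs : wt as ≤ wt xs
    was≤wxs = +-cancelˡ-≤ (toℕ i) (wt as) (wt xs) (≤-trans (+-monoˡ-≤ (wt as) i≤j) wa≤wx)

nCk>0 : ∀ {n r} → r ≤ n → 0 < n C r
nCk>0 {n}     {zero}  _         = s≤s z≤n
nCk>0 {suc n} {suc r} (s≤s r≤n) = subst (0 <_) (nCk+nC[k+1]≡[n+1]C[k+1] n r) (≤-trans (nCk>0 r≤n) (m≤m+n _ _))

binomKK>0 : ∀ (x b : Pt k d) → (x ≼ᵇ b) ≡ true → 0 < binomKK x b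
binomKK>0 []       []       _   = s≤s z≤n
binomKK>0 {k} (i ∷ xs) (j ∷ bs) x≼b = let i≤j , xs≼bs = ≼ᵇ-∷⁻ i j xs bs x≼b in
  *-mono-≤ {1} {_} {1} (nCk>0 (∸-monoʳ-≤ k i≤j)) (binomKK>0 xs bs xs≼bs)

binomKK-≼ᵇ : ∀ (x b : Pt k d) → (x ≼ᵇ b) ≡ false → binomKK x b ≡ 0
binomKK-≼ᵇ []       []       ()
binomKK-≼ᵇ {k} (i ∷ xs) (j ∷ bs) x⋠b with toℕ i ≤ᵇ toℕ j in i≤ᵇj
... | true  = trans (cong (((k ∸ toℕ i) C (k ∸ toℕ j)) *_) (binomKK-≼ᵇ xs bs x⋠b))
                    (*-zeroʳ ((k ∸ toℕ i) C (k ∸ toℕ j)))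
... | false = cong (_* binomKK xs bs) (k>n⇒nCk≡0 (∸-monoʳ-< j<i (toℕ≤pred[n] i)))
  where
    j<i : toℕ j < toℕ i
    j<i = ≰⇒> λ i≤j → contradiction (trans (sym i≤ᵇj) (≤ᵇ-complete i≤j)) λ ()

binomKK-refl : ∀ (b : Pt k d) → binomKK b b ≡ 1
binomKK-refl []       = refl
binomKK-refl {k} (i ∷ bs) rewrite nCn≡1 (k ∸ toℕ i) | binomKK-refl bs = refl

C[1+n,n]≡1+n : ∀ n → suc n C n ≡ suc n
C[1+n,n]≡1+n n = begin
  suc n C n            ≡⟨ nCk≡nC[n∸k] (n≤1+n n) ⟩
  suc n C (suc n ∸ n)  ≡⟨ cong (suc n C_) (m+n∸n≡m 1 n) ⟩
  suc n C 1            ≡⟨ nC1≡n (suc n) ⟩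
  suc n                ∎
  where open ≡-Reasoning

C-step-down : ∀ {t k} → suc t < k → 2 ≤ (k ∸ t) C (k ∸ suc t)
C-step-down {t} {k} t+1<k = begin
  2                              ≤⟨ s≤s (m<n⇒0<n∸m t+1<k) ⟩
  suc (k ∸ suc t)                ≡⟨ C[1+n,n]≡1+n (k ∸ suc t) ⟨
  suc (k ∸ suc t) C (k ∸ suc t)  ≡⟨ cong (_C (k ∸ suc t)) (+-∸-assoc 1 (<⇒≤ t+1<k)) ⟨
  (k ∸ t) C (k ∸ suc t)          ∎
  where open ≤-Reasoning

StepBelow : Pt k d → Pt k d → Set
StepBelow a b = (a ≼ᵇ b) ≡ true × suc (wt a) ≡ wt b × 2 ≤ binomKK a b

StepBelow-∷ : ∀ (i : Fin (suc k)) (a b : Pt k d) → StepBelow a b → StepBelow (i ∷ a) (i ∷ b)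
StepBelow-∷ {k} i a b (a≼b , wa+1≡wb , two≤) =
  a≼b′ , trans (sym (+-suc (toℕ i) (wt a))) (cong (toℕ i +_) wa+1≡wb) , two≤′
  where
    a≼b′ : ((i ∷ a) ≼ᵇ (i ∷ b)) ≡ true
    a≼b′ rewrite ≤ᵇ-complete (≤-refl {toℕ i}) = a≼b
    two≤′ : 2 ≤ binomKK (i ∷ a) (i ∷ b)
    two≤′ rewrite nCn≡1 (k ∸ toℕ i) | +-identityʳ (binomKK a b) = two≤

step-down : ∀ (b : Pt k d) → in0k b ≡ false → Σ (Pt k d) (λ a → StepBelow a b)
step-down (fzero ∷ bs) b∉ = let a , a⋖bs = step-down bs b∉ in fzero ∷ a , StepBelow-∷ fzero a bs a⋖bs
step-down {k} (fsuc i ∷ bs) b∉ with suc (toℕ i) ≡ᵇ k in i+1≟k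
... | true  = let a , a⋖bs = step-down bs b∉ in fsuc i ∷ a , StepBelow-∷ (fsuc i) a bs a⋖bs
... | false = inject₁ i ∷ bs , lowered≼ , cong (λ t → suc (t + wt bs)) (toℕ-inject₁ i) , two≤
  where
    lowered≼ : ((inject₁ i ∷ bs) ≼ᵇ (fsuc i ∷ bs)) ≡ true
    lowered≼ rewrite toℕ-inject₁ i | ≤ᵇ-complete (n≤1+n (toℕ i)) = ≼ᵇ-refl bs
    i+1<k : suc (toℕ i) < k
    i+1<k = ≤∧≢⇒< (toℕ≤pred[n] (fsuc i)) λ i+1≡k → contradiction (trans (sym i+1≟k) (≡ᵇ-complete i+1≡k)) λ ()
    two≤ : 2 ≤ binomKK (inject₁ i ∷ bs) (fsuc i ∷ bs)
    two≤ rewrite toℕ-inject₁ i | binomKK-refl bs | *-identityʳ ((k ∸ toℕ i) C (k ∸ suc (toℕ i))) =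
      C-step-down i+1<k

wtS-upper : ∀ (S : Subset k d) x → S x ≡ true → wt x ≤ wtS S
wtS-upper S x Sx = ∈⇒≤max (∈-map⁺ wt (∈-filterᵇ⁺ S (allPts-complete _) Sx))

wtS-least : ∀ (S : Subset k d) {B} → (∀ x → S x ≡ true → wt x ≤ B) → wtS S ≤ B
wtS-least {k} {d} S ≤B = max≤ (map wt (filterᵇ S (allPts k d))) λ w w∈ →
  let x , x∈ , w≡wx = ∈-map⁻ wt w∈ in subst (_≤ _) (sym w≡wx) (≤B x (∈-filterᵇ⁻ S (allPts k d) x∈))

module _ (S : Subset k d) where

  star-intro : ∀ {x} → S x ≡ true → wt x ≡ wtS S → star S x ≡ true
  star-intro {x} Sx wx≡ = trans (cong (_∧ (wt x ≡ᵇ wtS S)) Sx) (≡ᵇ-complete wx≡)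

  star⇒∈ : ∀ {x} → star S x ≡ true → S x ≡ true
  star⇒∈ {x} = ∧-conicalˡ (S x) (wt x ≡ᵇ wtS S)

  star⇒wt : ∀ {x} → star S x ≡ true → wt x ≡ wtS S
  star⇒wt {x} = ≡ᵇ-sound ∘ ∧-conicalʳ (S x) (wt x ≡ᵇ wtS S)

  star-nonempty : ∀ {x} → S x ≡ true → Σ (Pt k d) (λ b → star S b ≡ true)
  star-nonempty {x} Sx = b , star-intro (∈-filterᵇ⁻ S (allPts k d) b∈) (sym wtS≡wb)
    where
      wtS∈ = max∈ (∈-map⁺ wt (∈-filterᵇ⁺ S (allPts-complete x) Sx))
      b = proj₁ (∈-map⁻ wt wtS∈)
      b∈ = proj₁ (proj₂ (∈-map⁻ wt wtS∈))
      wtS≡wb = proj₂ (proj₂ (∈-map⁻ wt wtS∈))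

  Dn-intro : ∀ x {a} → star S a ≡ true → (x ≼ᵇ a) ≡ true → Dn S x ≡ true
  Dn-intro x {a} Sa x≼a = Equivalence.to T-≡ (any⁺ _ (lose (allPts-complete a)
    (Equivalence.from T-≡ (trans (cong (_∧ (x ≼ᵇ a)) Sa) x≼a))))

  Dn-elim : ∀ x → Dn S x ≡ true → Σ (Pt k d) (λ a → star S a ≡ true × (x ≼ᵇ a) ≡ true)
  Dn-elim x Dx = let a , a-witness = satisfied (any⁻ _ (allPts k d) (Equivalence.from T-≡ Dx)) in
    a , ∧≡true⁻ (star S a) (x ≼ᵇ a) (Equivalence.to T-≡ a-witness)

-- The b-th difference of n ↦ pTerm k n a b c i: that term is a constant times
-- C(n − (k + a), b + c + i − k), a polynomial of degree b + c + i − k ≤ b.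
pTermTop : (k a b c i : ℕ) → ℕ
pTermTop k a b c i =
  if (b + i ≤ᵇ k) ∧ (c + i ≤ᵇ k) ∧ (k ≤ᵇ b + c + i)
  then ((k ∸ a) C i) * (a C (k ∸ b ∸ i)) * (a C (k ∸ c ∸ i)) * (if b + c + i ∸ k ≡ᵇ b then 1 else 0)
  else 0

pJTop : (k a b c : ℕ) → ℕ
pJTop k a b c = sum (map (pTermTop k a b c) (upTo (suc k)))

pPtTop : ∀ {k d} → Pt k d → Pt k d → Pt k d → ℕ
pPtTop []       []       []       = 1
pPtTop {k} (a ∷ as) (b ∷ bs) (c ∷ cs) =
  ((toℕ b + wt bs) C toℕ b) * pJTop k (toℕ a) (toℕ b) (toℕ c) * pPtTop as bs cs

multinomial : ∀ {k d} → Pt k d → ℕ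
multinomial []       = 1
multinomial (b ∷ bs) = ((toℕ b + wt bs) C toℕ b) * multinomial bs

multinomial>0 : ∀ {k d} (b : Pt k d) → 0 < multinomial b
multinomial>0 []       = s≤s z≤n
multinomial>0 (b ∷ bs) = *-mono-≤ {1} {_} {1} (nCk>0 (m≤m+n (toℕ b) (wt bs))) (multinomial>0 bs)

module _ {k : ℕ} where
  open Polynomial (3 * k)

  pTerm-poly : ∀ a b c i → a ≤ k → Poly (λ n → pTerm k n a b c i) b (pTermTop k a b c i)
  pTerm-poly a b c i a≤k = Poly-if ((b + i ≤ᵇ k) ∧ (c + i ≤ᵇ k) ∧ (k ≤ᵇ b + c + i)) λ cond →
    Poly-scale (((k ∸ a) C i) * (a C (k ∸ b ∸ i)) * (a C (k ∸ c ∸ i)))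
      (Poly-raise≤ b (degree≤b (≤ᵇ-sound (∧-conicalˡ (c + i ≤ᵇ k) _ (∧-conicalʳ (b + i ≤ᵇ k) _ cond))))
        (Poly-cong (λ n _ → cong (_C (b + c + i ∸ k)) (sym (∸-+-assoc n k a)))
          (Poly-binomial (k + a) (b + c + i ∸ k) k+a≤3k)))
    where
      degree≤b : c + i ≤ k → b + c + i ∸ k ≤ b
      degree≤b c+i≤k = ≤-trans (∸-monoˡ-≤ k (subst (_≤ b + k) (sym (+-assoc b c i)) (+-monoʳ-≤ b c+i≤k)))
                               (≤-reflexive (m+n∸n≡m b k))
      k+a≤3k : k + a ≤ 3 * k
      k+a≤3k = +-monoʳ-≤ k (≤-trans a≤k (m≤m+n k (k + 0)))

  pJ-poly : ∀ a b c → a ≤ k → Poly (λ n → pJ k n a b c) b (pJTop k a b c)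
  pJ-poly a b c a≤k = Poly-sum (upTo (suc k)) λ i → pTerm-poly a b c i a≤k

  pPt-poly : ∀ (a b c : Pt k d) → Poly (λ n → pPt n a b c) (wt b) (pPtTop a b c)
  pPt-poly []       []       []       = Poly-const 1
  pPt-poly (a ∷ as) (b ∷ bs) (c ∷ cs) =
    Poly-* (toℕ b) (wt bs) (pJ-poly (toℕ a) (toℕ b) (toℕ c) (toℕ≤pred[n] a)) (pPt-poly as bs cs)

-- A term of top degree in n forces c + i = k.
pTermTop-vanishes : ∀ k a b c i → (c + i ≡ k → k < b + i) → pTermTop k a b c i ≡ 0
pTermTop-vanishes k a b c i top⇒ with (b + i ≤ᵇ k) ∧ (c + i ≤ᵇ k) ∧ (k ≤ᵇ b + c + i) in cond
... | false = refl
... | true with b + c + i ∸ k ≡ᵇ b in full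
...   | false = *-zeroʳ (((k ∸ a) C i) * (a C (k ∸ b ∸ i)) * (a C (k ∸ c ∸ i)))
...   | true  = contradiction (≤ᵇ-sound {b + i} {k} (∧-conicalˡ (b + i ≤ᵇ k) _ cond)) (<⇒≱ (top⇒ c+i≡k))
  where
    k≤b+c+i : k ≤ b + c + i
    k≤b+c+i = ≤ᵇ-sound (∧-conicalʳ (c + i ≤ᵇ k) _ (∧-conicalʳ (b + i ≤ᵇ k) _ cond))
    c+i≡k : c + i ≡ k
    c+i≡k = +-cancelˡ-≡ b (c + i) k (begin
      b + (c + i)          ≡⟨ +-assoc b c i ⟨
      b + c + i            ≡⟨ m∸n+n≡m k≤b+c+i ⟨
      b + c + i ∸ k + k    ≡⟨ cong (_+ k) (≡ᵇ-sound full) ⟩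
      b + k                ∎)
      where open ≡-Reasoning

pJTop-vanishes : ∀ k a b c → c < b → pJTop k a b c ≡ 0
pJTop-vanishes k a b c c<b = sum-zero (upTo (suc k)) λ i → pTermTop-vanishes k a b c i λ c+i≡k →
  subst (_< b + i) c+i≡k (+-monoˡ-< i c<b)

pJTop-diagonal : ∀ k a b → b ≤ k → pJTop k a b b ≡ (k ∸ a) C (k ∸ b)
pJTop-diagonal k a b b≤k = begin
  sum (map (pTermTop k a b b) (applyUpTo (λ i → i) (suc k)))
    ≡⟨ cong sum (map-applyUpTo (λ i → i) _ (suc k)) ⟩
  sum (applyUpTo (pTermTop k a b b) (suc k))
    ≡⟨ sum-applyUpTo-single _ (s≤s (m∸n≤m k b)) others ⟩
  pTermTop k a b b (k ∸ b)
    ≡⟨ diagonal-term ⟩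
  (k ∸ a) C (k ∸ b) ∎
  where
    open ≡-Reasoning
    others : ∀ i → i ≢ k ∸ b → pTermTop k a b b i ≡ 0
    others i i≢ = pTermTop-vanishes k a b b i λ b+i≡k →
      contradiction (trans (sym (m+n∸m≡n b i)) (cong (_∸ b) b+i≡k)) i≢
    b+[k∸b]≡k = m+[n∸m]≡n b≤k
    diagonal-term : pTermTop k a b b (k ∸ b) ≡ (k ∸ a) C (k ∸ b)
    diagonal-term
      rewrite b+[k∸b]≡k | +-assoc b b (k ∸ b) | b+[k∸b]≡k
            | ≤ᵇ-complete (≤-refl {k}) | ≤ᵇ-complete (m≤n+m k b) | m+n∸n≡m b k | ≡ᵇ-complete (refl {x = b}) | n∸n≡0 (k ∸ b)
      = trans (*-identityʳ _) (trans (*-identityʳ _) (*-identityʳ _))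

pPtTop-vanishes : ∀ {k d} (a b c : Pt k d) → (b ≼ᵇ c) ≡ false → pPtTop a b c ≡ 0
pPtTop-vanishes []       []       []       ()
pPtTop-vanishes {k} (a ∷ as) (b ∷ bs) (c ∷ cs) b⋠c with toℕ b ≤ᵇ toℕ c in b≤ᵇc
... | true  = trans (cong (top *_) (pPtTop-vanishes as bs cs b⋠c)) (*-zeroʳ top)
  where top = ((toℕ b + wt bs) C toℕ b) * pJTop k (toℕ a) (toℕ b) (toℕ c)
... | false = trans (cong (λ t → ((toℕ b + wt bs) C toℕ b) * t * pPtTop as bs cs)
                          (pJTop-vanishes k (toℕ a) (toℕ b) (toℕ c) c<b))
                    (cong (_* pPtTop as bs cs) (*-zeroʳ ((toℕ b + wt bs) C toℕ b)))
  where
    c<b = ≰⇒> λ b≤c → contradiction (trans (sym b≤ᵇc) (≤ᵇ-complete b≤c)) λ ()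

pPtTop-diagonal : ∀ {k d} (a b : Pt k d) → pPtTop a b b ≡ multinomial b * binomKK a b
pPtTop-diagonal []       []       = refl
pPtTop-diagonal {k} (a ∷ as) (b ∷ bs)
  rewrite pJTop-diagonal k (toℕ a) (toℕ b) (toℕ≤pred[n] b) | pPtTop-diagonal as bs =
  interchange ((toℕ b + wt bs) C toℕ b) ((k ∸ toℕ a) C (k ∸ toℕ b)) (multinomial bs) (binomKK as bs)
  where
    interchange : ∀ x y z w → x * y * (z * w) ≡ x * z * (y * w)
    interchange = solve-∀

module LeadingCoefficient {k d : ℕ} (β : Subset k d) where
  open Polynomial (3 * k)

  private
    all : List (Pt k d)
    all = allPts k d

  leadingCoeff : Pt k d → ℕ
  leadingCoeff a = sum (map (λ b → if star β b then multinomial b * binomKK a b else 0) all)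

  star-≼ᵇ⇒≡ : ∀ {b b'} → star β b ≡ true → star β b' ≡ true → (b ≼ᵇ b') ≡ true → b ≡ b'
  star-≼ᵇ⇒≡ {b} {b'} b* b'* b≼b' =
    ≼ᵇ∧wt≥⇒≡ b b' b≼b' (≤-reflexive (trans (star⇒wt β b'*) (sym (star⇒wt β b*))))

  pSet-poly : ∀ a → Poly (λ n → pSet n a β β) (wtS β) (leadingCoeff a)
  pSet-poly a = Poly-cong (λ n _ → sym (pSet-unfiltered n)) (Poly-sum all row-poly)
    where
      pSet-unfiltered : ∀ n → pSet n a β β ≡
        sum (map (λ b → if β b then sum (map (λ c → if β c then pPt n a b c else 0) all) else 0) all)
      pSet-unfiltered n = trans (sum-filterᵇ β _ all) (sum-cong all λ b →
        if-cong-then (β b) (sum-filterᵇ β (pPt n a b) all))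

      row-top : ∀ b →
        (if β b then sum (map (λ c → if β c then (if wt b ≡ᵇ wtS β then pPtTop a b c else 0) else 0) all) else 0)
        ≡ (if star β b then multinomial b * binomKK a b else 0)
      row-top b with β b in βb
      ... | false = refl
      ... | true with wt b ≡ᵇ wtS β in b-top
      ...   | false = sum-zero all λ c → if-eta (β c)
      ...   | true  = trans (sum-allPts-single _ b off-diagonal)
                            (trans (cong (λ t → if t then pPtTop a b b else 0) βb) (pPtTop-diagonal a b))
        where
          off-diagonal : ∀ c → c ≢ b → (if β c then pPtTop a b c else 0) ≡ 0
          off-diagonal c c≢b with β c in βc
          ... | false = refl
          ... | true with b ≼ᵇ c in b≼c
          ...   | false = pPtTop-vanishes a b c b≼c
          ...   | true  = contradiction (sym (≼ᵇ∧wt≥⇒≡ b c b≼c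
                            (≤-trans (wtS-upper β c βc) (≤-reflexive (sym (≡ᵇ-sound b-top)))))) c≢b

      row-poly : ∀ b → Poly (λ n → if β b then sum (map (λ c → if β c then pPt n a b c else 0) all) else 0)
                            (wtS β) (if star β b then multinomial b * binomKK a b else 0)
      row-poly b = subst (Poly _ (wtS β)) (row-top b) (Poly-if (β b) λ βb → Poly-sum all λ c →
        Poly-if (β c) λ _ → Poly-raise≤ (wtS β) (wtS-upper β b βb) (pPt-poly a b c))

  leadingCoeff-star : ∀ {b} → star β b ≡ true → leadingCoeff b ≡ multinomial b
  leadingCoeff-star {b} b* = begin
    leadingCoeff b                                          ≡⟨ sum-allPts-single _ b off-diagonal ⟩
    (if star β b then multinomial b * binomKK b b else 0)   ≡⟨ cong (λ t → if t then _ else 0) b* ⟩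
    multinomial b * binomKK b b                             ≡⟨ cong (multinomial b *_) (binomKK-refl b) ⟩
    multinomial b * 1                                       ≡⟨ *-identityʳ _ ⟩
    multinomial b                                           ∎
    where
      open ≡-Reasoning
      off-diagonal : ∀ c → c ≢ b → (if star β c then multinomial c * binomKK b c else 0) ≡ 0
      off-diagonal c c≢b with star β c in c*
      ... | false = refl
      ... | true with b ≼ᵇ c in b≼c
      ...   | false = trans (cong (multinomial c *_) (binomKK-≼ᵇ b c b≼c)) (*-zeroʳ (multinomial c))
      ...   | true  = contradiction (sym (star-≼ᵇ⇒≡ b* c* b≼c)) c≢b

  leadingCoeff≡M*Nsum : ∀ M → (∀ b → star β b ≡ true → multinomial b ≡ M) →
                        ∀ a → leadingCoeff a ≡ M * Nsum β a
  leadingCoeff≡M*Nsum M multinomial≡M a = begin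
    leadingCoeff a
      ≡⟨ sum-cong all term ⟩
    sum (map (λ b → M * (if (a ≼ᵇ b) ∧ star β b then binomKK a b else 0)) all)
      ≡⟨ sum-scale M _ all ⟩
    M * sum (map (λ b → if (a ≼ᵇ b) ∧ star β b then binomKK a b else 0) all)
      ≡⟨ cong (M *_) (sum-filterᵇ (λ b → (a ≼ᵇ b) ∧ star β b) (binomKK a) all) ⟨
    M * Nsum β a ∎
    where
      open ≡-Reasoning
      term : ∀ b → (if star β b then multinomial b * binomKK a b else 0)
                 ≡ M * (if (a ≼ᵇ b) ∧ star β b then binomKK a b else 0)
      term b with star β b in b* | a ≼ᵇ b in a≼b
      ... | false | false = sym (*-zeroʳ M)
      ... | false | true  = sym (*-zeroʳ M)
      ... | true  | true  = cong (_* binomKK a b) (multinomial≡M b b*)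
      ... | true  | false = trans (cong (multinomial b *_) (binomKK-≼ᵇ a b a≼b))
                                  (trans (*-zeroʳ (multinomial b)) (sym (*-zeroʳ M)))

  -- Nsum β a is definitionally sum (map (binomKK a) (dominators a)).
  dominators : Pt k d → List (Pt k d)
  dominators a = filterᵇ (λ b → (a ≼ᵇ b) ∧ star β b) all

  ∈-dominators⁺ : ∀ a {b} → star β b ≡ true → (a ≼ᵇ b) ≡ true → b ∈ dominators a
  ∈-dominators⁺ a {b} b* a≼b =
    ∈-filterᵇ⁺ (λ b → (a ≼ᵇ b) ∧ star β b) (allPts-complete b) (cong₂ _∧_ a≼b b*)

  ∈-dominators⁻ : ∀ a {b} → b ∈ dominators a → star β b ≡ true × (a ≼ᵇ b) ≡ true
  ∈-dominators⁻ a {b} b∈ =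
    swap (∧≡true⁻ (a ≼ᵇ b) (star β b) (∈-filterᵇ⁻ (λ b → (a ≼ᵇ b) ∧ star β b) all b∈))

  binomKK≤Nsum : ∀ a {b} → star β b ≡ true → (a ≼ᵇ b) ≡ true → binomKK a b ≤ Nsum β a
  binomKK≤Nsum a b* a≼b = ∈⇒≤sum (binomKK a) (∈-dominators⁺ a b* a≼b)

  Dn⇒Nsum>0 : ∀ x → Dn β x ≡ true → 0 < Nsum β x
  Dn⇒Nsum>0 x Dx with Dn-elim β x Dx
  ... | a , a* , x≼a = ≤-trans (binomKK>0 x a x≼a) (binomKK≤Nsum x a* x≼a)

  Nsum>0⇒Dn : ∀ x → 0 < Nsum β x → Dn β x ≡ true
  Nsum>0⇒Dn x N>0 with dominators x in x-dominators
  ... | []    = contradiction N>0 λ ()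
  ... | b ∷ _ = let b* , x≼b = ∈-dominators⁻ x (subst (b ∈_) (sym x-dominators) (here refl)) in
                Dn-intro β x b* x≼b

  Nsum-star : ∀ {c} → star β c ≡ true → Nsum β c ≡ 1
  Nsum-star {c} c* = begin
    Nsum β c
      ≡⟨ sum-filterᵇ (λ b → (c ≼ᵇ b) ∧ star β b) (binomKK c) all ⟩
    sum (map (λ b → if (c ≼ᵇ b) ∧ star β b then binomKK c b else 0) all)
      ≡⟨ sum-allPts-single _ c off-diagonal ⟩
    (if (c ≼ᵇ c) ∧ star β c then binomKK c c else 0)
      ≡⟨ cong₂ (λ s t → if s ∧ t then binomKK c c else 0) (≼ᵇ-refl c) c* ⟩
    binomKK c c
      ≡⟨ binomKK-refl c ⟩
    1 ∎
    where
      open ≡-Reasoning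
      off-diagonal : ∀ b → b ≢ c → (if (c ≼ᵇ b) ∧ star β b then binomKK c b else 0) ≡ 0
      off-diagonal b b≢c with c ≼ᵇ b in c≼b | star β b in b*
      ... | false | _     = refl
      ... | true  | false = refl
      ... | true  | true  = contradiction (sym (star-≼ᵇ⇒≡ c* b* c≼b)) b≢c

  Dn∖β-wt< : ∀ x → (Dn β ∖ β) x ≡ true → wt x < wtS β
  Dn∖β-wt< x x∈ with Dn-elim β x (∧-conicalˡ (Dn β x) (not (β x)) x∈)
  ... | a , a* , x≼a = ≤∧≢⇒< (≤-trans (≼ᵇ⇒wt≤ x a x≼a) (≤-reflexive (star⇒wt β a*))) λ wx≡ →
    let βx = subst (λ z → β z ≡ true) (sym (≼ᵇ∧wt≥⇒≡ x a x≼a (≤-reflexive (trans (star⇒wt β a*) (sym wx≡)))))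
                   (star⇒∈ β a*)
    in contradiction (trans (sym (cong not βx)) (∧-conicalʳ (Dn β x) (not (β x)) x∈)) λ ()

  leadingCoeff-determined : ∀ {m₀ m} → IsM0 k d m₀ → m₀ ≤ m → ∀ a a' →
    pSet m a β β ≡ pSet m a' β β → leadingCoeff a ≡ leadingCoeff a'
  leadingCoeff-determined (_ , polynomial-identity) m₀≤m a a' pSet≡ =
    Poly-top-unique (pSet-poly a) (pSet-poly a') (polynomial-identity _ m₀≤m β β a a' pSet≡)

module CellStructure {k d : ℕ} (lab : Pt k d → ℕ) (y : Pt k d)
  (leadingCoeff-invariant : ∀ a a' → lab a ≡ lab a' →
     LeadingCoefficient.leadingCoeff (cellOf lab y) a ≡ LeadingCoefficient.leadingCoeff (cellOf lab y) a') where

  β : Subset k d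
  β = cellOf lab y

  open LeadingCoefficient β public

  private
    all : List (Pt k d)
    all = allPts k d

  same-cell : ∀ {x x'} → β x ≡ true → β x' ≡ true → lab x ≡ lab x'
  same-cell βx βx' = trans (≡ᵇ-sound βx) (sym (≡ᵇ-sound βx'))

  b₀ : Pt k d
  b₀ = proj₁ (star-nonempty β (≡ᵇ-complete {lab y} refl))

  b₀* : star β b₀ ≡ true
  b₀* = proj₂ (star-nonempty β (≡ᵇ-complete {lab y} refl))

  multinomial-constant : ∀ b → star β b ≡ true → multinomial b ≡ multinomial b₀
  multinomial-constant b b* = begin
    multinomial b    ≡⟨ leadingCoeff-star b* ⟨
    leadingCoeff b   ≡⟨ leadingCoeff-invariant b b₀ (same-cell (star⇒∈ β b*) (star⇒∈ β b₀*)) ⟩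
    leadingCoeff b₀  ≡⟨ leadingCoeff-star b₀* ⟩
    multinomial b₀   ∎
    where open ≡-Reasoning

  Nsum-invariant : ∀ a a' → lab a ≡ lab a' → Nsum β a ≡ Nsum β a'
  Nsum-invariant a a' a~a' = *-cancelˡ-≡ (Nsum β a) (Nsum β a') M {{>-nonZero (multinomial>0 b₀)}} (begin
    M * Nsum β a     ≡⟨ leadingCoeff≡M*Nsum M multinomial-constant a ⟨
    leadingCoeff a   ≡⟨ leadingCoeff-invariant a a' a~a' ⟩
    leadingCoeff a'  ≡⟨ leadingCoeff≡M*Nsum M multinomial-constant a' ⟩
    M * Nsum β a'    ∎)
    where
      open ≡-Reasoning
      M = multinomial b₀

  Nsum-cell : ∀ x → β x ≡ true → Nsum β x ≡ 1
  Nsum-cell x βx = trans (Nsum-invariant x b₀ (same-cell βx (star⇒∈ β b₀*))) (Nsum-star b₀*)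

  Dn-saturated : ∀ x z → Dn β x ≡ true → lab z ≡ lab x → Dn β z ≡ true
  Dn-saturated x z Dx z~x = Nsum>0⇒Dn z (subst (0 <_) (Nsum-invariant x z (sym z~x)) (Dn⇒Nsum>0 x Dx))

  unique-dominator : ∀ x → β x ≡ true →
    Σ (Pt k d) (λ b → (star β b ≡ true × (x ≼ᵇ b) ≡ true)
      × (∀ b' → star β b' ≡ true → (x ≼ᵇ b') ≡ true → b' ≡ b))
  unique-dominator x βx with sum≡1⇒singleton (binomKK x) (dominators x) (Nsum-cell x βx)
                               (λ b b∈ → binomKK>0 x b (proj₂ (∈-dominators⁻ x b∈)))
  ... | b , ≡[b] = b , ∈-dominators⁻ x (subst (b ∈_) (sym ≡[b]) (here refl)) , unique
    where
      unique : ∀ b' → star β b' ≡ true → (x ≼ᵇ b') ≡ true → b' ≡ b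
      unique b' b'* x≼b' with subst (b' ∈_) ≡[b] (∈-dominators⁺ x b'* x≼b')
      ... | here b'≡b = b'≡b

  -- Lowering a coordinate of b ∈ β* strictly between 0 and k gives a ∉ β, since N(a) ≥ 2.
  weight-gap-or-0k : (Nonempty (Dn β ∖ β) × wtS (Dn β ∖ β) + 1 ≡ wtS β)
                   ⊎ (∀ b → star β b ≡ true → in0k b ≡ true)
  weight-gap-or-0k with ⇒-or-counterexample (star β) in0k all
  ... | inj₁ all-0k = inj₂ λ b b* → all-0k b (allPts-complete b) b*
  ... | inj₂ (b , b* , b∉) with step-down b b∉
  ...   | a , a≼b , wa+1≡wb , two≤ = inj₁ ((a , a∈) , gap)
    where
      open ≡-Reasoning
      a∉β : β a ≡ false
      a∉β with β a in βa
      ... | false = refl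
      ... | true  = contradiction (subst (2 ≤_) (Nsum-cell a βa) (≤-trans two≤ (binomKK≤Nsum a b* a≼b)))
                                  λ { (s≤s ()) }
      a∈ : (Dn β ∖ β) a ≡ true
      a∈ = cong₂ (λ s t → s ∧ not t) (Dn-intro β a b* a≼b) a∉β
      wtS≡wa : wtS (Dn β ∖ β) ≡ wt a
      wtS≡wa = ≤-antisym
        (wtS-least (Dn β ∖ β) λ x x∈ →
          ≤-pred (subst (wt x <_) (trans (sym (star⇒wt β b*)) (sym wa+1≡wb)) (Dn∖β-wt< x x∈)))
        (wtS-upper (Dn β ∖ β) a a∈)
      gap : wtS (Dn β ∖ β) + 1 ≡ wtS β
      gap = begin
        wtS (Dn β ∖ β) + 1  ≡⟨ cong (_+ 1) wtS≡wa ⟩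
        wt a + 1            ≡⟨ +-comm (wt a) 1 ⟩
        suc (wt a)          ≡⟨ wa+1≡wb ⟩
        wt b                ≡⟨ star⇒wt β b* ⟩
        wtS β               ∎

proposition3p3 : (k d : ℕ) → 1 ≤ k → 1 ≤ d →
    (m₀ : ℕ) → IsM0 k d m₀ → (m : ℕ) → m₀ ≤ m →
    (lab : Pt k d → ℕ) →
    (∀ x → lab x ≡ lab (zeroPt k d) → x ≡ zeroPt k d) →
    (∀ (a a' y z : Pt k d) → lab a ≡ lab a' →
       pSet m a (cellOf lab y) (cellOf lab z) ≡ pSet m a' (cellOf lab y) (cellOf lab z)) →
    (y : Pt k d) →
    ((∀ x z → Dn (cellOf lab y) x ≡ true → lab z ≡ lab x → Dn (cellOf lab y) z ≡ true)
     × (∀ x → (Dn (cellOf lab y) ∖ cellOf lab y) x ≡ true → wt x < wtS (cellOf lab y)))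
    × (∀ (z : Pt k d) → Σ ℕ (λ N → ∀ a → lab a ≡ lab z → Nsum (cellOf lab y) a ≡ N))
    × (∀ x → cellOf lab y x ≡ true →
         Σ (Pt k d) (λ b → (star (cellOf lab y) b ≡ true × (x ≼ᵇ b) ≡ true)
           × (∀ b' → star (cellOf lab y) b' ≡ true → (x ≼ᵇ b') ≡ true → b' ≡ b)))
    × ((Nonempty (Dn (cellOf lab y) ∖ cellOf lab y)
          × wtS (Dn (cellOf lab y) ∖ cellOf lab y) + 1 ≡ wtS (cellOf lab y))
       ⊎ (∀ b → star (cellOf lab y) b ≡ true → in0k b ≡ true))
proposition3p3 k d _ _ m₀ isM0 m m₀≤m lab _ fusion y =
  (Dn-saturated , Dn∖β-wt<) ,
  (λ z → Nsum β z , λ a a~z → Nsum-invariant a z a~z) ,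
  unique-dominator ,
  weight-gap-or-0k
  where
    open CellStructure lab y (λ a a' a~a' →
      LeadingCoefficient.leadingCoeff-determined (cellOf lab y) isM0 m₀≤m a a' (fusion a a' y y a~a'))
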